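{- In the construction described in the context, let $\pi'$ be an $(i^*,j^*)$-canonical elimination order for $G'$, for some $i^*,j^*\in[r]$. Then: (1) no vertex that is eliminated before the first vertex of $B'_{j^*}$ costs more than $3rn$; (2) when a vertex of $D'_{j^*}\cup X'_{i^*}$ is eliminated, its cost does not exceed $3rn+\frac n2$; (3) no vertex that is eliminated after $X'_{i^*}$ costs more than $3rn$.
   Context: Elimination: eliminating $v$ removes $v$ and adds all missing edges between its neighbors. An elimination order is a permutation of the vertices, eliminated one by one; the cost of eliminating a vertex is the size of its closed neighborhood at that moment, and the cost $c_G(\pi)$ of an order $\pi$ on $G$ is the maximum over all vertices. Construction. Let $r\ge1$, let $n$ be a positive even integer and $k$ a positive integer with $k<n/2$. For each $i,j\in[r]$ let $G_{i,j}$ be a cobipartite graph with partite sets $A_{i,j}=\{a^1_{i,j},\dots,a^n_{i,j}\}$ and $B_{i,j}=\{b^1_{i,j},\dots,b^n_{i,j}\}$ (both cliques), such that $A_{i,j}$ has a perfect matching into $B_{i,j}$. The graph $G'$ has vertices $\hat a^p_i$, $\hat b^p_i$, $c^p_i$, $d^p_i$ for $i\in[r]$, $p\in[n]$, and $x^p_i$ for $i\in[r]$, $p\in[n/2]$. Write $A'_i=\{\hat a^p_i\}_p$, $B'_i=\{\hat b^p_i\}_p$, $C'_i=\{c^p_i\}_p$ (checking vertices), $D'_i=\{d^p_i\}_p$ (dummy vertices), $X'_i=\{x^p_i\}_p$ (blanker vertices). Edges: $A':=\bigcup_i(A'_i\cup C'_i)$ is a clique; $B':=\bigcup_i(B'_i\cup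 D'_i\cup X'_i)$ is a clique; for $i,j\in[r]$, $p,q\in[n]$, $\hat a^p_i\hat b^q_j$ is an edge iff $a^p_{i,j}b^q_{i,j}\in E(G_{i,j})$; every vertex of $C'_i$ is adjacent to all of $B'_i$; every vertex of $D'_i$ is adjacent to all of $\bigcup_{j\in[r]}A'_j$ and to all of $C'_i$; every vertex of $X'_i$ is adjacent to all of $A'_i$; there are no other edges. Let $k':=3rn+\frac n2+k$. An elimination order $\pi'$ of $G'$ is $(i^*,j^*)$-canonical if it eliminates: first, for all $i\in[r]\setminus\{i^*\}$, the sets $X'_i$, one whole set at a time; then the vertices of $B'_{j^*}$, followed by $D'_{j^*}$, followed by $X'_{i^*}$; then, alternatingly, a set $B'_i$ followed by the corresponding $D'_i$, until all of $\bigcup_i(B'_i\cup D'_i)$ is eliminated; and finally all vertices of $\bigcup_i(A'_i\cup C'_i)$ in arbitrary order. -}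

module Defs where

open import Data.Nat using (ℕ; zero; suc; _+_; _*_; _≤_; _<_)
open import Data.Nat.DivMod using (_/_)
open import Data.Fin using (Fin) renaming (_≟_ to _≟F_)
open import Data.Bool using (Bool; true; false; _∧_; _∨_; not; T)
open import Data.List using (List; []; _∷_; _++_; map; concatMap; length; filterᵇ; foldl)
open import Data.List.Membership.Propositional using (_∈_)
open import Data.List.Relation.Unary.All using (All)
open import Data.List.Relation.Unary.Unique.Propositional using (Unique)
open import Data.Product using (Σ; _×_; _,_; proj₁; proj₂; ∃-syntax)
open import Data.Empty using (⊥)
open import Data.Unit using (⊤)
open import Function.Definitions using (Injective)
open import Relation.Binary.PropositionalEquality using (_≡_; _≢_; refl; cong₂)
open import Relation.Nullary using (Dec; yes; no; does)

Adj : Set → Set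
Adj V = V → V → Bool

Enumerates : {A : Set} → (A → Set) → List A → Set
Enumerates P L = Unique L × (∀ v → v ∈ L → P v) × (∀ v → P v → v ∈ L)

IsEliminationOrder : {A : Set} → List A → Set
IsEliminationOrder π = Unique π × (∀ v → v ∈ π)

-- Eliminating v: adds all edges between neighbours of v.  (Vertex v itself
-- is removed by the fact that it no longer occurs in the rest of the order;
-- edges touching already eliminated vertices are never inspected again.)
eliminate : {V : Set} → Adj V → V → Adj V
eliminate E v u w = E u w ∨ (E u v ∧ E v w)

eliminateAll : {V : Set} → Adj V → List V → Adj V
eliminateAll E xs = foldl eliminate E xs

-- If the order is  xs ++ v ∷ ys, the cost of eliminating v is the size of
-- its closed neighbourhood in the current graph, whose vertex set is v ∷ ys:
-- 1 + number of neighbours of v among ys.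
elimCost : {V : Set} → Adj V → List V → V → List V → ℕ
elimCost E xs v ys = suc (length (filterᵇ (eliminateAll E xs v) ys))

data V (r n : ℕ) : Set where
  â b̂ c d : Fin r → Fin n → V r n
  x       : Fin r → Fin (n / 2) → V r n

_≟V_ : {r n : ℕ} → (u v : V r n) → Dec (u ≡ v)
â i p ≟V â j q with i ≟F j | p ≟F q
... | yes refl | yes refl = yes refl
... | no ne | _ = no λ { refl → ne refl }
... | _ | no ne = no λ { refl → ne refl }
b̂ i p ≟V b̂ j q with i ≟F j | p ≟F q
... | yes refl | yes refl = yes refl
... | no ne | _ = no λ { refl → ne refl }
... | _ | no ne = no λ { refl → ne refl }
c i p ≟V c j q with i ≟F j | p ≟F q
... | yes refl | yes refl = yes refl
... | no ne | _ = no λ { refl → ne refl }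
... | _ | no ne = no λ { refl → ne refl }
d i p ≟V d j q with i ≟F j | p ≟F q
... | yes refl | yes refl = yes refl
... | no ne | _ = no λ { refl → ne refl }
... | _ | no ne = no λ { refl → ne refl }
x i p ≟V x j q with i ≟F j | p ≟F q
... | yes refl | yes refl = yes refl
... | no ne | _ = no λ { refl → ne refl }
... | _ | no ne = no λ { refl → ne refl }
â _ _ ≟V b̂ _ _ = no λ ()
â _ _ ≟V c _ _ = no λ ()
â _ _ ≟V d _ _ = no λ ()
â _ _ ≟V x _ _ = no λ ()
b̂ _ _ ≟V â _ _ = no λ ()
b̂ _ _ ≟V c _ _ = no λ ()
b̂ _ _ ≟V d _ _ = no λ ()
b̂ _ _ ≟V x _ _ = no λ ()
c _ _ ≟V â _ _ = no λ ()
c _ _ ≟V b̂ _ _ = no λ ()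
c _ _ ≟V d _ _ = no λ ()
c _ _ ≟V x _ _ = no λ ()
d _ _ ≟V â _ _ = no λ ()
d _ _ ≟V b̂ _ _ = no λ ()
d _ _ ≟V c _ _ = no λ ()
d _ _ ≟V x _ _ = no λ ()
x _ _ ≟V â _ _ = no λ ()
x _ _ ≟V b̂ _ _ = no λ ()
x _ _ ≟V c _ _ = no λ ()
x _ _ ≟V d _ _ = no λ ()

-- The cobipartite graphs G_{i,j} are given by their cross edges:
-- CrossEdges r n i j p q = true  iff  a^p_{i,j} b^q_{i,j} ∈ E(G_{i,j}).
-- (A_{i,j} and B_{i,j} are cliques, so this determines G_{i,j}.)
CrossEdges : ℕ → ℕ → Set
CrossEdges r n = Fin r → Fin r → Fin n → Fin n → Bool

HasPerfectMatching : {n : ℕ} → (Fin n → Fin n → Bool) → Set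
HasPerfectMatching {n} R =
  Σ (Fin n → Fin n) λ σ → Injective _≡_ _≡_ σ × (∀ p → T (R p (σ p)))

_==_ : {r : ℕ} → Fin r → Fin r → Bool
i == j = does (i ≟F j)

rawEdge : {r n : ℕ} → CrossEdges r n → V r n → V r n → Bool
-- A' = ⋃ (A'_i ∪ C'_i) is a clique
rawEdge G (â _ _) (â _ _) = true
rawEdge G (â _ _) (c _ _) = true
rawEdge G (c _ _) (c _ _) = true
-- B' = ⋃ (B'_i ∪ D'_i ∪ X'_i) is a clique
rawEdge G (b̂ _ _) (b̂ _ _) = true
rawEdge G (b̂ _ _) (d _ _) = true
rawEdge G (b̂ _ _) (x _ _) = true
rawEdge G (d _ _) (d _ _) = true
rawEdge G (d _ _) (x _ _) = true
rawEdge G (x _ _) (x _ _) = true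
rawEdge G (â i p) (b̂ j q) = G i j p q
rawEdge G (c i _) (b̂ j _) = i == j
rawEdge G (d _ _) (â _ _) = true
rawEdge G (d i _) (c j _) = i == j
rawEdge G (x i _) (â j _) = i == j
rawEdge G _ _ = false

G' : {r n : ℕ} → CrossEdges r n → Adj (V r n)
G' G u v = not (does (u ≟V v)) ∧ (rawEdge G u v ∨ rawEdge G v u)

InA InB InC InD : {r n : ℕ} → Fin r → V r n → Set
InA i (â j _) = i ≡ j
InA i _ = ⊥
InB i (b̂ j _) = i ≡ j
InB i _ = ⊥
InC i (c j _) = i ≡ j
InC i _ = ⊥
InD i (d j _) = i ≡ j
InD i _ = ⊥

InX : {r n : ℕ} → Fin r → V r n → Set
InX i (x j _) = i ≡ j
InX i _ = ⊥

InAC : {r n : ℕ} → V r n → Set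
InAC (â _ _) = ⊤
InAC (c _ _) = ⊤
InAC _ = ⊥

Canonical : (r n : ℕ) → Fin r → Fin r → List (V r n) → Set
Canonical r n i* j* π =
  Σ (List (Fin r × List (V r n))) λ blocks₁ →
  Σ (List (V r n)) λ L₂ → Σ (List (V r n)) λ L₃ → Σ (List (V r n)) λ L₄ →
  Σ (List (Fin r × List (V r n) × List (V r n))) λ blocks₅ →
  Σ (List (V r n)) λ L₆ →
    (π ≡ concatMap proj₂ blocks₁ ++ L₂ ++ L₃ ++ L₄
           ++ concatMap (λ t → proj₁ (proj₂ t) ++ proj₂ (proj₂ t)) blocks₅ ++ L₆)
    -- phase 1: the sets X'_i, i ≠ i*, one whole set at a time
  × Enumerates (λ i → i ≢ i*) (map proj₁ blocks₁)
  × All (λ t → Enumerates (InX (proj₁ t)) (proj₂ t)) blocks₁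
    -- phase 2: B'_{j*}, then D'_{j*}, then X'_{i*}
  × Enumerates (InB j*) L₂
  × Enumerates (InD j*) L₃
  × Enumerates (InX i*) L₄
    -- phase 3: alternatingly B'_i followed by D'_i, for the remaining i ≠ j*
  × Enumerates (λ i → i ≢ j*) (map proj₁ blocks₅)
  × All (λ t → Enumerates (InB (proj₁ t)) (proj₁ (proj₂ t))
             × Enumerates (InD (proj₁ t)) (proj₂ (proj₂ t))) blocks₅
    -- phase 4: all of ⋃_i (A'_i ∪ C'_i), in arbitrary order
  × Enumerates InAC L₆

module Submission where

-- Fix the moment a vertex v is eliminated. Let P ∋ v be a class of vertices containing
-- everything eliminated so far, and Z a class of vertices none of which is adjacent to P.
-- Eliminating a vertex of P only joins neighbours of that vertex, so P stays non-adjacent to Z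
-- and the closed neighbourhood of v consists of uneliminated vertices outside Z. These are
-- counted by sending them injectively to 3rn slots, one per vertex of B', D' and A'
-- (plus n/2 slots for X'_{i*} in part (2)); uneliminated vertices of C' and X' take the
-- slots of vertices that are already eliminated or lie in Z:
--  * while X'_cur is eliminated (cur ≠ i*), P is the started sets X'_i and Z is C' together
--    with A'_i for the unstarted i; an unstarted X'_i takes the lower half of the slots of
--    A'_i and X'_cur the upper half of those of A'_{i*};
--  * at D'_{j*} ∪ X'_{i*}, Z = ⋃_{i ≠ j*} C'_i and C'_{j*} takes the slots of B'_{j*};
--  * while B'_cur ∪ D'_cur is eliminated, Z is C'_i for the unstarted i; C'_cur takes the
--    slots of B'_{j*} and C'_i for the finished i those of D'_i;
--  * once B' ∪ D' ∪ X' is gone, Z is empty and C' takes the slots of D'.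

open import Defs
open import Data.Nat using (ℕ; _+_; _*_; _≤_; _<_)
open import Data.Nat.DivMod using (_/_; m/n≤m; m*[n/m]≡n)
open import Data.Nat.Divisibility using (_∣_)
open import Data.Nat.Properties using (+-identityʳ; ≤-trans; <⇒≤)
open import Data.Fin using (Fin; zero; suc; inject≤; fromℕ<) renaming (_≟_ to _≟F_)
open import Data.Fin.Properties using (injective⇒≤; *↔×; +↔⊎)
open import Data.Bool using (Bool; false; T)
open import Data.Bool.Properties using (∧-zeroʳ)
open import Data.Empty using (⊥)
open import Data.Unit using (⊤)
open import Data.Product using (_×_; _,_; proj₁; proj₂; ∃)
open import Data.Product.Function.NonDependent.Propositional using (_×-↔_)
open import Data.Sum using (_⊎_; inj₁; inj₂; [_,_]′)
open import Data.Sum.Function.Propositional using (_⊎-↔_)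
open import Data.List using (List; []; _∷_; _++_; length; lookup; filterᵇ; concatMap; map)
open import Data.List.Properties using (∷-injective; ++-assoc; concatMap-++; ++-monoid)
open import Data.List.Membership.Propositional using (_∈_; _∉_; find; lose)
open import Data.List.Membership.Propositional.Properties
  using (∈-lookup; ∈-filter⁻; ∈-++⁺ˡ; ∈-++⁺ʳ; ∈-++⁻; ∈-concatMap⁻; ∈-concatMap⁺; ∈-∃++;
         ∈-map⁺; ∈-map⁻)
open import Data.List.Relation.Binary.Subset.Propositional using (_⊆_)
open import Data.List.Relation.Binary.Subset.Propositional.Properties using (map⁺)
import Data.List.Relation.Unary.All as All
open All using (All; []; _∷_)
import Data.List.Relation.Unary.All.Properties as Allₚ
open import Data.List.Relation.Unary.Any using (here; there)
open import Data.List.Relation.Unary.Unique.Propositional using (Unique; []; _∷_)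
import Data.List.Relation.Unary.Unique.Propositional.Properties as Uniqueₚ
open Uniqueₚ using (Unique[x∷xs]⇒x∉xs)
open import Function using (_∘_)
open import Function.Bundles using (_↣_; _↔_; Injection; Inverse)
open import Function.Properties.Inverse using (↔-refl; ↔-sym; ↔-trans; ↔⇒↣)
open import Relation.Nullary using (¬_; yes; no; contradiction)
open import Relation.Nullary.Decidable using (T?)
open import Relation.Binary.PropositionalEquality
  using (_≡_; _≢_; refl; sym; trans; cong; subst; module ≡-Reasoning)
open import Tactic.MonoidSolver using (solve)

private variable
  A W S : Set

lookup-injective : ∀ {xs : List A} → Unique xs → ∀ i j → lookup xs i ≡ lookup xs j → i ≡ j
lookup-injective (_  ∷ _)   zero    zero    _ = refl
lookup-injective (x∉ ∷ _)   zero    (suc j) e = contradiction e (All.lookup x∉ (∈-lookup j))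
lookup-injective (x∉ ∷ _)   (suc i) zero    e = contradiction (sym e) (All.lookup x∉ (∈-lookup i))
lookup-injective (_  ∷ xs!) (suc i) (suc j) e = cong suc (lookup-injective xs! i j e)

injectiveOn⇒length≤ : ∀ {m} {xs : List A} → Unique xs → (f : A → Fin m) →
  (∀ {a b} → a ∈ xs → b ∈ xs → f a ≡ f b → a ≡ b) → length xs ≤ m
injectiveOn⇒length≤ xs! f inj =
  injective⇒≤ λ {i} {j} e → lookup-injective xs! i j (inj (∈-lookup i) (∈-lookup j) e)

Unique-++⁻ʳ : ∀ xs {zs : List A} → Unique (xs ++ zs) → Unique zs
Unique-++⁻ʳ []       zs!       = zs!
Unique-++⁻ʳ (_ ∷ xs) (_ ∷ xs!) = Unique-++⁻ʳ xs xs!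

Unique-++-disjoint : ∀ xs {zs : List A} {u} → Unique (xs ++ zs) → u ∈ xs → u ∉ zs
Unique-++-disjoint (_ ∷ xs) (x∉ ∷ _)  (here refl) u∈zs = All.lookup x∉ (∈-++⁺ʳ xs u∈zs) refl
Unique-++-disjoint (_ ∷ xs) (_ ∷ xs!) (there u∈xs) = Unique-++-disjoint xs xs! u∈xs

private
  module Regroup {A : Set} (l₁ l₂ l₃ l₄ l₅ : List A) where
    at₂ : (l₁ ++ l₂) ++ (l₃ ++ l₄) ++ l₅ ≡ l₁ ++ l₂ ++ l₃ ++ l₄ ++ l₅
    at₂ = solve (++-monoid A)
    at₃ : (l₁ ++ l₂ ++ l₃) ++ l₄ ++ l₅ ≡ l₁ ++ l₂ ++ l₃ ++ l₄ ++ l₅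
    at₃ = solve (++-monoid A)
    at₄ : (l₁ ++ l₂ ++ l₃ ++ l₄) ++ l₅ ≡ l₁ ++ l₂ ++ l₃ ++ l₄ ++ l₅
    at₄ = solve (++-monoid A)
    around₂ : (l₁ ++ l₂) ++ l₃ ++ l₄ ++ l₅ ≡ l₁ ++ (l₂ ++ l₃ ++ l₄) ++ l₅
    around₂ = solve (++-monoid A)
    around₃ : (l₁ ++ l₂ ++ l₃) ++ l₄ ++ l₅ ≡ l₁ ++ (l₂ ++ l₃ ++ l₄) ++ l₅
    around₃ = solve (++-monoid A)

record InBlock {B : Set} (f : B → List A) (bs : List B) (P xs : List A) (v : A) : Set where
  field
    done      : List B
    current   : B
    later     : List B
    split     : bs ≡ done ++ current ∷ later
    v∈current : v ∈ f current
    finished  : P ++ concatMap f done ⊆ xs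
    started   : xs ⊆ P ++ concatMap f done ++ f current

  done⊆ : done ⊆ bs
  done⊆ t∈ = subst (_ ∈_) (sym split) (∈-++⁺ˡ t∈)

  current∈ : current ∈ bs
  current∈ = subst (current ∈_) (sym split) (∈-++⁺ʳ done (here refl))

module _ {xs : List A} {v : A} {ys : List A} (π! : Unique (xs ++ v ∷ ys)) where

  prefix⊆before : ∀ P Q → P ++ Q ≡ xs ++ v ∷ ys → v ∈ Q → P ⊆ xs
  prefix⊆before = go π!
    where
    go : ∀ {xs} → Unique (xs ++ v ∷ ys) → ∀ P Q → P ++ Q ≡ xs ++ v ∷ ys → v ∈ Q → P ⊆ xs
    go {[]}     v∷ys! (_ ∷ P) Q eq v∈Q with refl , eq′ ← ∷-injective eq =
      contradiction (subst (v ∈_) eq′ (∈-++⁺ʳ P v∈Q)) (Unique[x∷xs]⇒x∉xs v∷ys!)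
    go {a ∷ xs} (_ ∷ xs!) (_ ∷ P) Q eq v∈Q with refl , eq′ ← ∷-injective eq = λ where
      (here refl)  → here refl
      (there u∈P) → there (go xs! P Q eq′ v∈Q u∈P)

  before⊆prefix : ∀ P Q → P ++ Q ≡ xs ++ v ∷ ys → v ∈ P → xs ⊆ P
  before⊆prefix = go π!
    where
    go : ∀ {xs} → Unique (xs ++ v ∷ ys) → ∀ P Q → P ++ Q ≡ xs ++ v ∷ ys → v ∈ P → xs ⊆ P
    go {[]}     _         _       _ _  _           = λ ()
    go {a ∷ xs} (a∉ ∷ _)  (_ ∷ P) _ eq (here refl) with refl , _ ← ∷-injective eq =
      contradiction refl (All.lookup a∉ (∈-++⁺ʳ xs (here refl)))
    go {a ∷ xs} (_ ∷ xs!) (_ ∷ P) Q eq (there v∈P) with refl , eq′ ← ∷-injective eq = λ where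
      (here refl)  → here refl
      (there u∈xs) → there (go xs! P Q eq′ v∈P u∈xs)

  inBlock : ∀ {B : Set} (f : B → List A) P bs Q → P ++ concatMap f bs ++ Q ≡ xs ++ v ∷ ys →
    v ∈ concatMap f bs → InBlock f bs P xs v
  inBlock f P bs Q eq v∈bs =
    let current , current∈bs , v∈current = find (∈-concatMap⁻ f {xs = bs} v∈bs)
        done , later , split = ∈-∃++ current∈bs
        D = concatMap f done ; C = f current ; L = concatMap f later
        eq′ : P ++ (D ++ C ++ L) ++ Q ≡ xs ++ v ∷ ys
        eq′ = begin
          P ++ (D ++ C ++ L) ++ Q
            ≡⟨ cong (λ R → P ++ R ++ Q) (concatMap-++ f done (current ∷ later)) ⟨
          P ++ concatMap f (done ++ current ∷ later) ++ Q
            ≡⟨ cong (λ bs → P ++ concatMap f bs ++ Q) split ⟨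
          P ++ concatMap f bs ++ Q
            ≡⟨ eq ⟩
          xs ++ v ∷ ys ∎
    in record
      { done      = done
      ; current   = current
      ; later     = later
      ; split     = split
      ; v∈current = v∈current
      ; finished  = prefix⊆before (P ++ D) (C ++ L ++ Q)
          (trans (Regroup.around₂ P D C L Q) eq′) (∈-++⁺ˡ v∈current)
      ; started   = before⊆prefix (P ++ D ++ C) (L ++ Q)
          (trans (Regroup.around₃ P D C L Q) eq′) (∈-++⁺ʳ P (∈-++⁺ʳ D v∈current))
      }
    where open ≡-Reasoning

enumerated : ∀ {P : A → Set} {L} → Enumerates P L → ∀ {u} → u ∈ L → P u
enumerated (_ , sound , _) = sound _

enumerates : ∀ {P : A → Set} {L} → Enumerates P L → ∀ {u} → P u → u ∈ L
enumerates (_ , _ , complete) = complete _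

module _ {B I : Set} (idx : B → I) (f : B → List A) (C : I → A → Set) where

  concatMap-classified : ∀ {bs} → (∀ {t u} → t ∈ bs → u ∈ f t → C (idx t) u) →
    ∀ {u} → u ∈ concatMap f bs → ∃ λ i → i ∈ map idx bs × C i u
  concatMap-classified {bs} classified u∈ with t , t∈bs , u∈t ← find (∈-concatMap⁻ f {xs = bs} u∈) =
    idx t , ∈-map⁺ idx t∈bs , classified t∈bs u∈t

  concatMap-complete : ∀ {bs} → (∀ {t u} → t ∈ bs → C (idx t) u → u ∈ f t) →
    ∀ {i u} → i ∈ map idx bs → C i u → u ∈ concatMap f bs
  concatMap-complete complete i∈ Ciu with t , t∈bs , refl ← ∈-map⁻ idx i∈ =
    ∈-concatMap⁺ f (lose t∈bs (complete t∈bs Ciu))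

-- Elimination

Separated : Adj W → (W → Set) → (W → Set) → Set
Separated E P Z = ∀ u w → P u → Z w → E u w ≡ false

eliminate-separated : ∀ {E : Adj W} {P Z s} → Separated E P Z → P s → Separated (eliminate E s) P Z
eliminate-separated {E = E} {s = s} sep Ps u w Pu Zw rewrite sep u w Pu Zw | sep s w Ps Zw =
  ∧-zeroʳ (E u s)

eliminateAll-separated : ∀ {E : Adj W} {P Z xs} → Separated E P Z → All P xs →
  Separated (eliminateAll E xs) P Z
eliminateAll-separated sep []         = sep
eliminateAll-separated sep (Ps ∷ Pxs) = eliminateAll-separated (eliminate-separated sep Ps) Pxs

elimCost≤ : ∀ {m} (E : Adj W) {P Z : W → Set} {xs v ys} →
  Unique (xs ++ v ∷ ys) → Separated E P Z → All P xs → P v → ¬ Z v →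
  (ι : S ↣ Fin m) (slot : W → S) (unslot : S → W) →
  (∀ {a} → a ∉ xs → ¬ Z a → unslot (slot a) ≡ a) →
  elimCost E xs v ys ≤ m
elimCost≤ {W = W} E {P} {Z} {xs} {v} {ys} π! sep Pxs Pv ¬Zv ι slot unslot retract =
  injectiveOn⇒length≤ N! (Injection.to ι ∘ slot) λ a∈N b∈N e →
    begin
      _ ≡⟨ sym (retract (uneliminated a∈N) (outside a∈N)) ⟩
      unslot (slot _) ≡⟨ cong unslot (Injection.injective ι e) ⟩
      unslot (slot _) ≡⟨ retract (uneliminated b∈N) (outside b∈N) ⟩
      _ ∎
  where
  open ≡-Reasoning
  F : W → Bool
  F = eliminateAll E xs v
  N : List W
  N = v ∷ filterᵇ F ys
  v∷ys! : Unique (v ∷ ys)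
  v∷ys! = Unique-++⁻ʳ xs π!
  N! : Unique N
  N! with v∉ys ∷ ys! ← v∷ys! = Allₚ.filter⁺ (T? ∘ F) v∉ys ∷ Uniqueₚ.filter⁺ (T? ∘ F) ys!
  uneliminated : ∀ {a} → a ∈ N → a ∉ xs
  uneliminated (here refl) a∈xs = Unique-++-disjoint xs π! a∈xs (here refl)
  uneliminated (there a∈F) a∈xs =
    Unique-++-disjoint xs π! a∈xs (there (proj₁ (∈-filter⁻ (T? ∘ F) {xs = ys} a∈F)))
  outside : ∀ {a} → a ∈ N → ¬ Z a
  outside (here refl) = ¬Zv
  outside (there a∈F) Za =
    subst T (eliminateAll-separated sep Pxs v _ Pv Za) (proj₂ (∈-filter⁻ (T? ∘ F) {xs = ys} a∈F))

-- The graph G'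

module _ {r n : ℕ} where

  ≢⇒==false : (i j : Fin r) → i ≢ j → (i == j) ≡ false
  ≢⇒==false i j i≢j with i ≟F j
  ... | yes i≡j = contradiction i≡j i≢j
  ... | no  _   = refl

  nonadjacent : (G : CrossEdges r n) (u w : V r n) →
    rawEdge G u w ≡ false → rawEdge G w u ≡ false → G' G u w ≡ false
  nonadjacent G u w e₁ e₂ rewrite e₁ | e₂ = ∧-zeroʳ _

  X-in : (Fin r → Set) → V r n → Set
  X-in S (x i _) = S i
  X-in S _       = ⊥

  AC-outside : (Fin r → Set) → V r n → Set
  AC-outside S (â i _) = ¬ S i
  AC-outside S (c _ _) = ⊤
  AC-outside S _       = ⊥

  BDX-in : (Fin r → Set) → V r n → Set
  BDX-in S (b̂ i _) = S i
  BDX-in S (d i _) = S i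
  BDX-in S (x _ _) = ⊤
  BDX-in S _       = ⊥

  C-outside : (Fin r → Set) → V r n → Set
  C-outside S (c i _) = ¬ S i
  C-outside S _       = ⊥

  X-in-separated : (G : CrossEdges r n) (S : Fin r → Set) →
    Separated (G' G) (X-in S) (AC-outside S)
  X-in-separated G S (x i q) (â j p) Si ¬Sj =
    nonadjacent G (x i q) (â j p) (≢⇒==false i j λ { refl → ¬Sj Si }) refl
  X-in-separated G S (x i q) (c j p) _  _   = nonadjacent G (x i q) (c j p) refl refl
  X-in-separated G S (x _ _) (b̂ _ _) _ ()
  X-in-separated G S (x _ _) (d _ _) _ ()
  X-in-separated G S (x _ _) (x _ _) _ ()
  X-in-separated G S (â _ _) _ ()
  X-in-separated G S (b̂ _ _) _ ()
  X-in-separated G S (c _ _) _ ()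
  X-in-separated G S (d _ _) _ ()

  BDX-in-separated : (G : CrossEdges r n) (S : Fin r → Set) →
    Separated (G' G) (BDX-in S) (C-outside S)
  BDX-in-separated G S (b̂ i q) (c j p) Si ¬Sj =
    nonadjacent G (b̂ i q) (c j p) refl (≢⇒==false j i λ { refl → ¬Sj Si })
  BDX-in-separated G S (d i q) (c j p) Si ¬Sj =
    nonadjacent G (d i q) (c j p) (≢⇒==false i j λ { refl → ¬Sj Si }) refl
  BDX-in-separated G S (x i q) (c j p) _  _   = nonadjacent G (x i q) (c j p) refl refl
  BDX-in-separated G S (â _ _) (c _ _) ()
  BDX-in-separated G S (c _ _) (c _ _) ()
  BDX-in-separated G S _ (â _ _) _ ()
  BDX-in-separated G S _ (b̂ _ _) _ ()
  BDX-in-separated G S _ (d _ _) _ ()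
  BDX-in-separated G S _ (x _ _) _ ()

  X-in⇒¬AC-outside : ∀ {S u} → X-in S u → ¬ AC-outside S u
  X-in⇒¬AC-outside {u = x _ _} _ ()
  X-in⇒¬AC-outside {u = â _ _} ()
  X-in⇒¬AC-outside {u = b̂ _ _} ()
  X-in⇒¬AC-outside {u = c _ _} ()
  X-in⇒¬AC-outside {u = d _ _} ()

  BDX-in⇒¬C-outside : ∀ {S u} → BDX-in S u → ¬ C-outside S u
  BDX-in⇒¬C-outside {u = â _ _} ()
  BDX-in⇒¬C-outside {u = c _ _} ()
  BDX-in⇒¬C-outside {u = b̂ _ _} _ ()
  BDX-in⇒¬C-outside {u = d _ _} _ ()
  BDX-in⇒¬C-outside {u = x _ _} _ ()

  InX⇒X-in : ∀ {S i u} → InX i u → S i → X-in S u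
  InX⇒X-in {u = x _ _} refl Si = Si
  InX⇒X-in {u = â _ _} ()
  InX⇒X-in {u = b̂ _ _} ()
  InX⇒X-in {u = c _ _} ()
  InX⇒X-in {u = d _ _} ()

  InX⇒BDX-in : ∀ {S i u} → InX i u → BDX-in S u
  InX⇒BDX-in {u = x _ _} _ = _
  InX⇒BDX-in {u = â _ _} ()
  InX⇒BDX-in {u = b̂ _ _} ()
  InX⇒BDX-in {u = c _ _} ()
  InX⇒BDX-in {u = d _ _} ()

  InBD⇒BDX-in : ∀ {S i u} → InB i u ⊎ InD i u → S i → BDX-in S u
  InBD⇒BDX-in {u = b̂ _ _} (inj₁ refl) Si = Si
  InBD⇒BDX-in {u = d _ _} (inj₂ refl) Si = Si
  InBD⇒BDX-in {u = b̂ _ _} (inj₂ ())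
  InBD⇒BDX-in {u = d _ _} (inj₁ ())
  InBD⇒BDX-in {u = â _ _} (inj₁ ())
  InBD⇒BDX-in {u = â _ _} (inj₂ ())
  InBD⇒BDX-in {u = c _ _} (inj₁ ())
  InBD⇒BDX-in {u = c _ _} (inj₂ ())
  InBD⇒BDX-in {u = x _ _} (inj₁ ())
  InBD⇒BDX-in {u = x _ _} (inj₂ ())

-- Slots

Fin↔halves : ∀ {n} → 2 ∣ n → Fin n ↔ (Fin (n / 2) ⊎ Fin (n / 2))
Fin↔halves {n} 2∣n = ↔-trans (subst (λ m → Fin n ↔ Fin m) n≡half+half ↔-refl) +↔⊎
  where
  n≡half+half : n ≡ n / 2 + n / 2
  n≡half+half = sym (trans (cong (n / 2 +_) (sym (+-identityʳ (n / 2)))) (m*[n/m]≡n 2∣n))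

Slot : ℕ → ℕ → Set
Slot r n = (Fin 3 × Fin r) × Fin n

pattern B-slot i p = ((zero , i) , p)
pattern D-slot i p = ((suc zero , i) , p)
pattern A-slot i p = ((suc (suc zero) , i) , p)

module _ {r n : ℕ} where

  Slot↔ : Fin (3 * r * n) ↔ Slot r n
  Slot↔ = ↔-trans *↔× (*↔× ×-↔ ↔-refl)

  Slot↣ : Slot r n ↣ Fin (3 * r * n)
  Slot↣ = ↔⇒↣ (↔-sym Slot↔)

  Slot⊎Fin↣ : (Slot r n ⊎ Fin (n / 2)) ↣ Fin (3 * r * n + n / 2)
  Slot⊎Fin↣ = ↔⇒↣ (↔-sym Fin↔Slot⊎Fin)
    where
    Fin↔Slot⊎Fin : Fin (3 * r * n + n / 2) ↔ (Slot r n ⊎ Fin (n / 2))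
    Fin↔Slot⊎Fin = ↔-trans (+↔⊎ {3 * r * n} {n / 2}) (Slot↔ ⊎-↔ ↔-refl)

-- Cost in each phase

module _ {r n : ℕ} (G : CrossEdges r n) {xs : List (V r n)} {v : V r n} {ys : List (V r n)} where

  open Inverse using (to; from; strictlyInverseˡ)
  open import Data.List.Membership.DecPropositional (_≟F_ {r}) using (_∈?_)

  blanker-phase-cost : (halves : Fin n ↔ (Fin (n / 2) ⊎ Fin (n / 2)))
    (i* cur : Fin r) (done : List (Fin r)) →
    i* ∉ cur ∷ done → Unique (xs ++ v ∷ ys) →
    All (X-in (_∈ cur ∷ done)) xs → X-in (_∈ cur ∷ done) v →
    (∀ {i} p → i ∈ done → x i p ∈ xs) →
    elimCost (G' G) xs v ys ≤ 3 * r * n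
  blanker-phase-cost halves i* cur done i*-unstarted π! Pxs Pv done-eliminated =
    elimCost≤ (G' G) π! (X-in-separated G Started) Pxs Pv (X-in⇒¬AC-outside Pv)
      Slot↣ slot unslot retract
    where
    Started : Fin r → Set
    Started = _∈ cur ∷ done

    slot : V r n → Slot r n
    slot (b̂ i p) = B-slot i p
    slot (c i p) = B-slot i p  -- C' ⊆ Z, so this slot is never used
    slot (d i p) = D-slot i p
    slot (â i p) = A-slot i p
    slot (x i p) with i ≟F cur
    ... | yes _ = A-slot i* (from halves (inj₂ p))
    ... | no  _ = A-slot i  (from halves (inj₁ p))

    blanker : Fin r → Fin (n / 2) ⊎ Fin (n / 2) → V r n
    blanker i (inj₁ p) = x i p
    blanker _ (inj₂ p) = x cur p

    unslot : Slot r n → V r n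
    unslot (B-slot i p) = b̂ i p
    unslot (D-slot i p) = d i p
    unslot (A-slot i q) with i ∈? cur ∷ done
    ... | yes _ = â i q
    ... | no  _ = blanker i (to halves q)

    retract : ∀ {a} → a ∉ xs → ¬ AC-outside Started a → unslot (slot a) ≡ a
    retract {b̂ i p} _ _ = refl
    retract {d i p} _ _ = refl
    retract {c i p} _ ¬Z = contradiction _ ¬Z
    retract {â i q} _ ¬Z with i ∈? cur ∷ done
    ... | yes _ = refl
    ... | no  ¬Si = contradiction ¬Si ¬Z
    retract {x i p} x∉xs _ with i ≟F cur
    retract {x i p} x∉xs _ | yes refl with i* ∈? cur ∷ done
    ... | yes i*-started = contradiction i*-started i*-unstarted
    ... | no  _ = cong (blanker i*) (strictlyInverseˡ halves (inj₂ p))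
    retract {x i p} x∉xs _ | no i≢cur with i ∈? cur ∷ done
    ... | yes (here i≡cur)  = contradiction i≡cur i≢cur
    ... | yes (there i∈done) = contradiction (done-eliminated p i∈done) x∉xs
    ... | no  _ = cong (blanker i) (strictlyInverseˡ halves (inj₁ p))

  middle-phase-cost : (i* j* : Fin r) → Unique (xs ++ v ∷ ys) →
    All (BDX-in (_≡ j*)) xs → BDX-in (_≡ j*) v →
    (∀ {i} p → i ≢ i* → x i p ∈ xs) → (∀ p → b̂ j* p ∈ xs) →
    elimCost (G' G) xs v ys ≤ 3 * r * n + n / 2
  middle-phase-cost i* j* π! Pxs Pv others-eliminated B-eliminated =
    elimCost≤ (G' G) π! (BDX-in-separated G (_≡ j*)) Pxs Pv (BDX-in⇒¬C-outside Pv)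
      Slot⊎Fin↣ slot unslot retract
    where
    slot : V r n → Slot r n ⊎ Fin (n / 2)
    slot (b̂ i p) = inj₁ (B-slot i p)
    slot (c i p) = inj₁ (B-slot i p)
    slot (d i p) = inj₁ (D-slot i p)
    slot (â i p) = inj₁ (A-slot i p)
    slot (x _ p) = inj₂ p

    unslot : Slot r n ⊎ Fin (n / 2) → V r n
    unslot (inj₁ (B-slot i p)) with i ≟F j*
    ... | yes _ = c i p
    ... | no  _ = b̂ i p
    unslot (inj₁ (D-slot i p)) = d i p
    unslot (inj₁ (A-slot i p)) = â i p
    unslot (inj₂ p)            = x i* p

    retract : ∀ {a} → a ∉ xs → ¬ C-outside (_≡ j*) a → unslot (slot a) ≡ a
    retract {b̂ i p} b∉xs _ with i ≟F j*
    ... | yes refl = contradiction (B-eliminated p) b∉xs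
    ... | no  _    = refl
    retract {c i p} _ ¬Z with i ≟F j*
    ... | yes _   = refl
    ... | no  i≢j* = contradiction i≢j* ¬Z
    retract {d i p} _ _ = refl
    retract {â i p} _ _ = refl
    retract {x i p} x∉xs _ with i ≟F i*
    ... | yes refl = refl
    ... | no  i≢i* = contradiction (others-eliminated p i≢i*) x∉xs

  pair-phase-cost : (j* cur : Fin r) (finished : List (Fin r)) → Unique (xs ++ v ∷ ys) →
    All (BDX-in (_∈ cur ∷ finished)) xs → BDX-in (_∈ cur ∷ finished) v →
    (∀ i p → x i p ∈ xs) → (∀ p → b̂ j* p ∈ xs) → (∀ {i} p → i ∈ finished → d i p ∈ xs) →
    elimCost (G' G) xs v ys ≤ 3 * r * n
  pair-phase-cost j* cur finished π! Pxs Pv X-eliminated B-eliminated D-eliminated =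
    elimCost≤ (G' G) π! (BDX-in-separated G Started) Pxs Pv (BDX-in⇒¬C-outside Pv)
      Slot↣ slot unslot retract
    where
    Started : Fin r → Set
    Started = _∈ cur ∷ finished

    slot : V r n → Slot r n
    slot (b̂ i p) = B-slot i p
    slot (c i p) with i ≟F cur
    ... | yes _ = B-slot j* p
    ... | no  _ = D-slot i p
    slot (d i p) = D-slot i p
    slot (â i p) = A-slot i p
    slot (x i p) = B-slot i (inject≤ p (m/n≤m n 2))  -- all of X' is eliminated: any slot will do

    unslot : Slot r n → V r n
    unslot (B-slot i p) with i ≟F j*
    ... | yes _ = c cur p
    ... | no  _ = b̂ i p
    unslot (D-slot i p) with i ∈? finished
    ... | yes _ = c i p
    ... | no  _ = d i p
    unslot (A-slot i p) = â i p

    retract : ∀ {a} → a ∉ xs → ¬ C-outside Started a → unslot (slot a) ≡ a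
    retract {b̂ i p} b∉xs _ with i ≟F j*
    ... | yes refl = contradiction (B-eliminated p) b∉xs
    ... | no  _    = refl
    retract {c i p} _ ¬Z with i ≟F cur
    retract {c i p} _ ¬Z | yes refl with j* ≟F j*
    ... | yes _    = refl
    ... | no  j*≢j* = contradiction refl j*≢j*
    retract {c i p} _ ¬Z | no i≢cur with i ∈? finished
    ... | yes _          = refl
    ... | no  i∉finished =
      contradiction (λ { (here i≡cur) → i≢cur i≡cur ; (there i∈) → i∉finished i∈ }) ¬Z
    retract {d i p} d∉xs _ with i ∈? finished
    ... | yes i∈finished = contradiction (D-eliminated p i∈finished) d∉xs
    ... | no  _          = refl
    retract {â i p} _ _ = refl
    retract {x i p} x∉xs _ = contradiction (X-eliminated i p) x∉xs

  last-phase-cost : Unique (xs ++ v ∷ ys) →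
    (∀ i p → x i p ∈ xs) → (∀ i p → d i p ∈ xs) →
    elimCost (G' G) xs v ys ≤ 3 * r * n
  last-phase-cost π! X-eliminated D-eliminated =
    elimCost≤ (G' G) {P = λ _ → ⊤} {Z = λ _ → ⊥} π! (λ _ _ _ ()) (All.universal _ xs) _ (λ ())
      Slot↣ slot unslot retract
    where
    slot : V r n → Slot r n
    slot (b̂ i p) = B-slot i p
    slot (c i p) = D-slot i p
    slot (d i p) = D-slot i p
    slot (â i p) = A-slot i p
    slot (x i p) = B-slot i (inject≤ p (m/n≤m n 2))  -- all of X' is eliminated: any slot will do

    unslot : Slot r n → V r n
    unslot (B-slot i p) = b̂ i p
    unslot (D-slot i p) = c i p
    unslot (A-slot i p) = â i p

    retract : ∀ {a} → a ∉ xs → ¬ ⊥ → unslot (slot a) ≡ a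
    retract {b̂ i p} _ _ = refl
    retract {c i p} _ _ = refl
    retract {â i p} _ _ = refl
    retract {d i p} d∉xs _ = contradiction (D-eliminated i p) d∉xs
    retract {x i p} x∉xs _ = contradiction (X-eliminated i p) x∉xs

-- Canonical orders

-- p₀ and q₀ only witness that B'_{j*} and X'_{i*} are nonempty.
module CanonicalOrder {r n : ℕ} (G : CrossEdges r n) (i* j* : Fin r)
  (halves : Fin n ↔ (Fin (n / 2) ⊎ Fin (n / 2))) (p₀ : Fin n) (q₀ : Fin (n / 2))
  {blocks₁ : List (Fin r × List (V r n))} {L₂ L₃ L₄ : List (V r n)}
  {blocks₅ : List (Fin r × List (V r n) × List (V r n))} {L₆ : List (V r n)}
  (E₁ : Enumerates (λ i → i ≢ i*) (map proj₁ blocks₁))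
  (A₁ : All (λ t → Enumerates (InX (proj₁ t)) (proj₂ t)) blocks₁)
  (E₂ : Enumerates (InB j*) L₂) (E₃ : Enumerates (InD j*) L₃) (E₄ : Enumerates (InX i*) L₄)
  (E₅ : Enumerates (λ i → i ≢ j*) (map proj₁ blocks₅))
  (A₅ : All (λ t → Enumerates (InB (proj₁ t)) (proj₁ (proj₂ t))
                 × Enumerates (InD (proj₁ t)) (proj₂ (proj₂ t))) blocks₅)
  {xs : List (V r n)} {v : V r n} {ys : List (V r n)} (π! : Unique (xs ++ v ∷ ys))
  (order : concatMap proj₂ blocks₁ ++ L₂ ++ L₃ ++ L₄
             ++ concatMap (λ t → proj₁ (proj₂ t) ++ proj₂ (proj₂ t)) blocks₅ ++ L₆
           ≡ xs ++ v ∷ ys)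
  where

  BD : Fin r × List (V r n) × List (V r n) → List (V r n)
  BD t = proj₁ (proj₂ t) ++ proj₂ (proj₂ t)

  X-phase BD-phase early : List (V r n)
  X-phase  = concatMap proj₂ blocks₁
  BD-phase = concatMap BD blocks₅
  early    = X-phase ++ L₂ ++ L₃ ++ L₄

  open Regroup X-phase L₂ L₃ L₄ (BD-phase ++ L₆)

  order-at-L₃ : (X-phase ++ L₂) ++ (L₃ ++ L₄) ++ BD-phase ++ L₆ ≡ xs ++ v ∷ ys
  order-at-L₃ = trans at₂ order

  order-at-L₄ : (X-phase ++ L₂ ++ L₃) ++ L₄ ++ BD-phase ++ L₆ ≡ xs ++ v ∷ ys
  order-at-L₄ = trans at₃ order

  order-at-BD : early ++ BD-phase ++ L₆ ≡ xs ++ v ∷ ys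
  order-at-BD = trans at₄ order

  v∈order : v ∈ X-phase ++ L₂ ++ L₃ ++ L₄ ++ BD-phase ++ L₆
  v∈order = subst (v ∈_) (sym order) (∈-++⁺ʳ xs (here refl))

  v∉xs : v ∉ xs
  v∉xs v∈xs = Unique-++-disjoint xs π! v∈xs (here refl)

  X-block : ∀ {t u} → t ∈ blocks₁ → u ∈ proj₂ t → InX (proj₁ t) u
  X-block t∈ = enumerated (All.lookup A₁ t∈)

  X-block⁺ : ∀ {t u} → t ∈ blocks₁ → InX (proj₁ t) u → u ∈ proj₂ t
  X-block⁺ t∈ = enumerates (All.lookup A₁ t∈)

  BD-block : ∀ {t u} → t ∈ blocks₅ → u ∈ BD t → InB (proj₁ t) u ⊎ InD (proj₁ t) u
  BD-block {t} t∈ u∈ with All.lookup A₅ t∈ | ∈-++⁻ (proj₁ (proj₂ t)) u∈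
  ... | EB , _  | inj₁ u∈B = inj₁ (enumerated EB u∈B)
  ... | _  , ED | inj₂ u∈D = inj₂ (enumerated ED u∈D)

  BD-block⁺ : ∀ {t u} → t ∈ blocks₅ → InB (proj₁ t) u ⊎ InD (proj₁ t) u → u ∈ BD t
  BD-block⁺ {t} t∈ (inj₁ InB) = ∈-++⁺ˡ (enumerates (proj₁ (All.lookup A₅ t∈)) InB)
  BD-block⁺ {t} t∈ (inj₂ InD) =
    ∈-++⁺ʳ (proj₁ (proj₂ t)) (enumerates (proj₂ (All.lookup A₅ t∈)) InD)

  X-phase⁺ : ∀ {i u} → i ≢ i* → InX i u → u ∈ X-phase
  X-phase⁺ i≢i* = concatMap-complete proj₁ proj₂ InX X-block⁺ (enumerates E₁ i≢i*)

  BD-phase⁺ : ∀ {i u} → i ≢ j* → InB i u ⊎ InD i u → u ∈ BD-phase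
  BD-phase⁺ i≢j* =
    concatMap-complete proj₁ BD (λ i u → InB i u ⊎ InD i u) BD-block⁺ (enumerates E₅ i≢j*)

  early-classified : ∀ {S u} → S j* → u ∈ early → BDX-in S u
  early-classified Sj* u∈ with ∈-++⁻ X-phase u∈
  ... | inj₁ u∈X with _ , _ , InX ← concatMap-classified proj₁ proj₂ InX X-block u∈X =
    InX⇒BDX-in InX
  ... | inj₂ u∈L with ∈-++⁻ L₂ u∈L
  ... | inj₁ u∈L₂ = InBD⇒BDX-in (inj₁ (enumerated E₂ u∈L₂)) Sj*
  ... | inj₂ u∈L′ with ∈-++⁻ L₃ u∈L′
  ... | inj₁ u∈L₃ = InBD⇒BDX-in (inj₂ (enumerated E₃ u∈L₃)) Sj*
  ... | inj₂ u∈L₄ = InX⇒BDX-in (enumerated E₄ u∈L₄)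

  blanker-phase-bound : (∀ w → InB j* w → w ∈ ys) → elimCost (G' G) xs v ys ≤ 3 * r * n
  blanker-phase-bound B-later =
    blanker-phase-cost G halves i* cur Done i*-unstarted π!
      (All.tabulate (started-classified ∘ started)) (started-classified (∈-++⁺ʳ _ v∈current))
      done-eliminated
    where
    rest : List (V r n)
    rest = L₂ ++ L₃ ++ L₄ ++ BD-phase ++ L₆

    v∈X-phase : v ∈ X-phase
    v∈X-phase with ∈-++⁻ X-phase v∈order
    ... | inj₁ v∈X = v∈X
    ... | inj₂ v∈rest with ∈-++⁻ L₂ v∈rest
    ... | inj₁ v∈L₂ =
      contradiction (B-later v (enumerated E₂ v∈L₂)) (Unique[x∷xs]⇒x∉xs (Unique-++⁻ʳ xs π!))
    ... | inj₂ v∈R =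
      contradiction (B-later (b̂ j* p₀) refl)
        (Unique-++-disjoint xs π! (B-before (enumerates E₂ refl)) ∘ there)
      where
      B-before : L₂ ⊆ xs
      B-before = prefix⊆before π! (X-phase ++ L₂) (L₃ ++ L₄ ++ BD-phase ++ L₆)
        (trans (++-assoc X-phase L₂ _) order) v∈R ∘ ∈-++⁺ʳ X-phase

    open InBlock (inBlock π! proj₂ [] blocks₁ rest order v∈X-phase)

    cur : Fin r
    cur = proj₁ current
    Done : List (Fin r)
    Done = map proj₁ done

    i*-unstarted : i* ∉ cur ∷ Done
    i*-unstarted (here i*≡cur) = enumerated E₁ (∈-map⁺ proj₁ current∈) (sym i*≡cur)
    i*-unstarted (there i*∈Done) = enumerated E₁ (map⁺ proj₁ done⊆ i*∈Done) refl

    started-classified : ∀ {u} → u ∈ concatMap proj₂ done ++ proj₂ current → X-in (_∈ cur ∷ Done) u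
    started-classified = [ from-done , from-current ]′ ∘ ∈-++⁻ (concatMap proj₂ done)
      where
      from-done : ∀ {u} → u ∈ concatMap proj₂ done → X-in (_∈ cur ∷ Done) u
      from-done u∈ = let i , i∈ , InX = concatMap-classified proj₁ proj₂ InX (X-block ∘ done⊆) u∈
                     in InX⇒X-in InX (there i∈)
      from-current : ∀ {u} → u ∈ proj₂ current → X-in (_∈ cur ∷ Done) u
      from-current u∈ = InX⇒X-in (X-block current∈ u∈) (here refl)

    done-eliminated : ∀ {i} p → i ∈ Done → x i p ∈ xs
    done-eliminated p i∈ = finished (concatMap-complete proj₁ proj₂ InX (X-block⁺ ∘ done⊆) i∈ refl)

  middle-phase-bound : InD j* v ⊎ InX i* v → elimCost (G' G) xs v ys ≤ 3 * r * n + n / 2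
  middle-phase-bound v-class =
    middle-phase-cost G i* j* π! (All.tabulate (early-classified refl ∘ within-early))
      (early-classified refl v∈early) X-eliminated B-eliminated
    where
    v∈L₃L₄ : v ∈ L₃ ++ L₄
    v∈L₃L₄ = [ ∈-++⁺ˡ ∘ enumerates E₃ , ∈-++⁺ʳ L₃ ∘ enumerates E₄ ]′ v-class

    v∈early : v ∈ early
    v∈early = ∈-++⁺ʳ X-phase (∈-++⁺ʳ L₂ v∈L₃L₄)

    within-early : xs ⊆ early
    within-early = before⊆prefix π! early (BD-phase ++ L₆) order-at-BD v∈early

    before : X-phase ++ L₂ ⊆ xs
    before = prefix⊆before π! (X-phase ++ L₂) ((L₃ ++ L₄) ++ BD-phase ++ L₆) order-at-L₃
      (∈-++⁺ˡ v∈L₃L₄)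

    X-eliminated : ∀ {i} p → i ≢ i* → x i p ∈ xs
    X-eliminated p i≢i* = before (∈-++⁺ˡ (X-phase⁺ i≢i* refl))

    B-eliminated : ∀ p → b̂ j* p ∈ xs
    B-eliminated p = before (∈-++⁺ʳ X-phase (enumerates E₂ refl))

  late-phase-bound : (∀ w → InX i* w → w ∈ xs) → elimCost (G' G) xs v ys ≤ 3 * r * n
  late-phase-bound X*-before = [ pair-phase-bound , last-phase-bound ]′ (∈-++⁻ BD-phase v∈late)
    where
    v∈late : v ∈ BD-phase ++ L₆
    v∈late with ∈-++⁻ (X-phase ++ L₂ ++ L₃) (subst (v ∈_) (sym order-at-L₄) (∈-++⁺ʳ xs (here refl)))
    ... | inj₁ v∈XBD = contradiction (within (X*-before (x i* q₀) refl)) x*-absent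
      where
      within : xs ⊆ X-phase ++ L₂ ++ L₃
      within = before⊆prefix π! (X-phase ++ L₂ ++ L₃) (L₄ ++ BD-phase ++ L₆) order-at-L₄ v∈XBD
      x*-absent : x i* q₀ ∉ X-phase ++ L₂ ++ L₃
      x*-absent x∈ with ∈-++⁻ X-phase x∈
      ... | inj₁ x∈X with _ , i∈ , refl ← concatMap-classified proj₁ proj₂ InX X-block x∈X =
        enumerated E₁ i∈ refl
      ... | inj₂ x∈L with ∈-++⁻ L₂ x∈L
      ... | inj₁ x∈L₂ = enumerated E₂ x∈L₂
      ... | inj₂ x∈L₃ = enumerated E₃ x∈L₃
    ... | inj₂ v∈L with ∈-++⁻ L₄ v∈L
    ... | inj₁ v∈L₄ = contradiction (X*-before v (enumerated E₄ v∈L₄)) v∉xs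
    ... | inj₂ v∈late = v∈late

    earlier : early ⊆ xs
    earlier = prefix⊆before π! early (BD-phase ++ L₆) order-at-BD v∈late

    X-eliminated : ∀ i p → x i p ∈ xs
    X-eliminated i p with i ≟F i*
    ... | yes refl  = X*-before (x i* p) refl
    ... | no  i≢i* = earlier (∈-++⁺ˡ (X-phase⁺ i≢i* refl))

    B*-eliminated : ∀ p → b̂ j* p ∈ xs
    B*-eliminated p = earlier (∈-++⁺ʳ X-phase (∈-++⁺ˡ (enumerates E₂ refl)))

    D*-eliminated : ∀ p → d j* p ∈ xs
    D*-eliminated p = earlier (∈-++⁺ʳ X-phase (∈-++⁺ʳ L₂ (∈-++⁺ˡ (enumerates E₃ refl))))

    last-phase-bound : v ∈ L₆ → elimCost (G' G) xs v ys ≤ 3 * r * n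
    last-phase-bound v∈L₆ = last-phase-cost G π! X-eliminated D-eliminated
      where
      BD-eliminated : BD-phase ⊆ xs
      BD-eliminated = prefix⊆before π! (early ++ BD-phase) L₆
        (trans (++-assoc early BD-phase L₆) order-at-BD) v∈L₆ ∘ ∈-++⁺ʳ early

      D-eliminated : ∀ i p → d i p ∈ xs
      D-eliminated i p with i ≟F j*
      ... | yes refl  = D*-eliminated p
      ... | no  i≢j* = BD-eliminated (BD-phase⁺ i≢j* (inj₂ refl))

    pair-phase-bound : v ∈ BD-phase → elimCost (G' G) xs v ys ≤ 3 * r * n
    pair-phase-bound v∈BD =
      pair-phase-cost G j* cur (j* ∷ Done) π!
        (All.tabulate (started-classified ∘ started))
        (started-classified (∈-++⁺ʳ early (∈-++⁺ʳ (concatMap BD done) v∈current)))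
        X-eliminated B*-eliminated D-eliminated
      where
      open InBlock (inBlock π! BD early blocks₅ L₆ order-at-BD v∈BD)

      cur : Fin r
      cur = proj₁ current
      Done : List (Fin r)
      Done = map proj₁ done

      started-classified : ∀ {u} → u ∈ early ++ concatMap BD done ++ BD current →
        BDX-in (_∈ cur ∷ j* ∷ Done) u
      started-classified =
        [ early-classified (there (here refl))
        , [ from-done , from-current ]′ ∘ ∈-++⁻ (concatMap BD done)
        ]′ ∘ ∈-++⁻ early
        where
        from-done : ∀ {u} → u ∈ concatMap BD done → BDX-in (_∈ cur ∷ j* ∷ Done) u
        from-done u∈ =
          let i , i∈ , InBD =
                concatMap-classified proj₁ BD (λ i u → InB i u ⊎ InD i u) (BD-block ∘ done⊆) u∈
          in InBD⇒BDX-in InBD (there (there i∈))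
        from-current : ∀ {u} → u ∈ BD current → BDX-in (_∈ cur ∷ j* ∷ Done) u
        from-current u∈ = InBD⇒BDX-in (BD-block current∈ u∈) (here refl)

      D-eliminated : ∀ {i} p → i ∈ j* ∷ Done → d i p ∈ xs
      D-eliminated p (here refl) = D*-eliminated p
      D-eliminated p (there i∈) =
        finished (∈-++⁺ʳ early (concatMap-complete proj₁ BD (λ i u → InB i u ⊎ InD i u)
          (BD-block⁺ ∘ done⊆) i∈ (inj₂ refl)))

lemma3 : (r n k : ℕ) → 1 ≤ r → 1 ≤ n → 2 ∣ n → 1 ≤ k → k < n / 2 →
         (G : CrossEdges r n) → (∀ i j → HasPerfectMatching (G i j)) →
         (i* j* : Fin r) → (π : List (V r n)) →
         IsEliminationOrder π → Canonical r n i* j* π →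
         (∀ xs v ys → π ≡ xs ++ v ∷ ys → (∀ w → InB j* w → w ∈ ys) →
            elimCost (G' G) xs v ys ≤ 3 * r * n)
       × (∀ xs v ys → π ≡ xs ++ v ∷ ys → InD j* v ⊎ InX i* v →
            elimCost (G' G) xs v ys ≤ 3 * r * n + n / 2)
       × (∀ xs v ys → π ≡ xs ++ v ∷ ys → (∀ w → InX i* w → w ∈ xs) →
            elimCost (G' G) xs v ys ≤ 3 * r * n)
lemma3 r n k _ 1≤n 2∣n 1≤k k<n/2 G _ i* j* π (π! , _)
       (blocks₁ , L₂ , L₃ , L₄ , blocks₅ , L₆ , π≡ , E₁ , A₁ , E₂ , E₃ , E₄ , E₅ , A₅ , _) =
  At.blanker-phase-bound , At.middle-phase-bound , At.late-phase-bound
  where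
  module At (xs : List (V r n)) (v : V r n) (ys : List (V r n)) (π≡xs : π ≡ xs ++ v ∷ ys) =
    CanonicalOrder G i* j* (Fin↔halves 2∣n) (fromℕ< {0} 1≤n) (fromℕ< {0} (≤-trans 1≤k (<⇒≤ k<n/2)))
      E₁ A₁ E₂ E₃ E₄ E₅ A₅ (subst Unique π≡xs π!) (trans (sym π≡) π≡xs)
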